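{- Let $G=(V,E)$ be a graph, $\varepsilon>0$, $b$ a positive integer, and consider the following random procedure. Let $M_1$ be a fixed $(\varepsilon/4)$-approximately maximal matching in $G$. For each edge of $M_1$ put one endpoint in $L$ and the other in $R$; put each vertex of $V\setminus V(M_1)$ independently and uniformly at random into $L$ or $R$. Let $E_2$ be the set of edges $(u,v)\in E$ with $u\in V(M_1)$, $v\notin V(M_1)$, and $u,v$ on different sides of $(L,R)$. Assign capacity $1$ to vertices of $V(M_1)$ and capacity $b$ to vertices of $V\setminus V(M_1)$, and let $M_2$ be any maximal $b$-matching in $(V,E_2)$ with these capacities. If $|M_1|=\left(\frac12+c\right)\mu(G)$, then $G[M_1\cup M_2]$ contains a set $\mathcal P$ of $3$-augmenting paths with respect to $M_1$ which are pairwise disjoint in their $V(M_1)$ vertices, with $$\mathbb E[|\mathcal P|]\ge\left(\frac14\left(\frac12-3c-\frac{7\varepsilon}{2}\right)-\frac2b\left(\frac12+c\right)\right)\mu(G),$$ where the expectation is over the random bipartition.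
   Context: $\mu(G)$ is the maximum matching size; $V(M)$ is the set of endpoints of a matching $M$; $G[F]$ is the subgraph formed by the edge set $F$. A matching $M$ is an $\varepsilon'$-approximately maximal matching if it is inclusion-wise maximal in some subgraph of $G$ obtained by deleting at most $\varepsilon'\mu(G)$ vertices. A $b$-matching with capacities $\{b_v\}$ is a multiset of edges in which each vertex $v$ is in at most $b_v$ elements; maximal means no edge copy can be added while respecting capacities. A $3$-augmenting path w.r.t. $M_1$ is a path $u'-u-v-v'$ with $(u,v)\in M_1$ and $u',v'$ distinct vertices unmatched by $M_1$.
   Formalization: The parameter ε ranges over the positive rationals rather than the positive reals, and c is taken rational. -}

module Defs where

open import Data.Nat as ℕ using (ℕ; zero; suc; _≤_; _^_)
open import Data.Nat.Properties using (m^n≢0)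
open import Data.Bool using (Bool; true; false; if_then_else_; _∨_; T; not)
open import Data.Fin using (Fin; _≟_)
open import Data.Vec using (Vec; []; _∷_; lookup)
open import Data.List using (List; []; _∷_; length; map; _++_)
open import Data.Bool.ListAction using (any)
open import Data.List.Membership.Propositional using (_∈_)
open import Data.List.Relation.Unary.AllPairs using (AllPairs)
open import Data.Product using (Σ; ∃; _×_; _,_; proj₁; proj₂)
open import Data.Sum using (_⊎_)
open import Data.Integer using (+_)
open import Data.Rational as ℚ using (ℚ; _/_; 0ℚ)
open import Relation.Nullary using (¬_)
open import Relation.Nullary.Decidable using (⌊_⌋)
open import Relation.Binary.PropositionalEquality using (_≡_; _≢_)

record Graph (n : ℕ) : Set where
  field
    adj   : Fin n → Fin n → Bool
    sym   : ∀ u v → adj u v ≡ adj v u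
    irref : ∀ v → adj v v ≡ false

open Graph public

-- An edge {u,v} is represented by an ordered pair (u , v).
Edge : ℕ → Set
Edge n = Fin n × Fin n

InG : ∀ {n} → Graph n → Edge n → Set
InG G (u , v) = T (adj G u v)

isEnd : ∀ {n} → Fin n → Edge n → Bool
isEnd v (x , y) = ⌊ x ≟ v ⌋ ∨ ⌊ y ≟ v ⌋

deg : ∀ {n} → List (Edge n) → Fin n → ℕ
deg [] v = 0
deg (e ∷ es) v = if isEnd v e then suc (deg es v) else deg es v

coveredᵇ : ∀ {n} → List (Edge n) → Fin n → Bool
coveredᵇ M v = any (isEnd v) M

Covered : ∀ {n} → List (Edge n) → Fin n → Set
Covered M v = T (coveredᵇ M v)

InList : ∀ {n} → List (Edge n) → Fin n → Fin n → Set
InList L u v = (u , v) ∈ L ⊎ (v , u) ∈ L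

IsMatching : ∀ {n} → Graph n → List (Edge n) → Set
IsMatching G M = (∀ {e} → e ∈ M → InG G e) × (∀ v → deg M v ≤ 1)

IsMaxMatchingSize : ∀ {n} → Graph n → ℕ → Set
IsMaxMatchingSize G m =
  (Σ (List (Edge _)) λ M → IsMatching G M × length M ≡ m) ×
  (∀ M → IsMatching G M → length M ≤ m)

IsMaximalMatchingAvoiding : ∀ {n} → Graph n → List (Fin n) → List (Edge n) → Set
IsMaximalMatchingAvoiding G D M =
  IsMatching G M ×
  (∀ v → v ∈ D → ¬ Covered M v) ×
  (∀ u v → T (adj G u v) → ¬ u ∈ D → ¬ v ∈ D → Covered M u ⊎ Covered M v)

ℕtoℚ : ℕ → ℚ
ℕtoℚ k = + k / 1

IsApproxMaximal : ∀ {n} → Graph n → (μ : ℕ) → (ε' : ℚ) → List (Edge n) → Set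
IsApproxMaximal {n} G μ ε' M =
  Σ (List (Fin n)) λ D →
    AllPairs _≢_ D ×
    ℚ._≤_ (ℕtoℚ (length D)) (ε' ℚ.* ℕtoℚ μ) ×
    IsMaximalMatchingAvoiding G D M

-- An outcome is σ : Vec Bool n; vertices of
-- V(M1) get the fixed side s0 v, the others get σ_v.  Averaging
-- uniformly over all σ ∈ Bool^n is the same as averaging over
-- independent uniform sides of the vertices in V ∖ V(M1).

side : ∀ {n} → List (Edge n) → (Fin n → Bool) → Vec Bool n → Fin n → Bool
side M1 s0 σ v = if coveredᵇ M1 v then s0 v else lookup σ v

E2 : ∀ {n} → Graph n → List (Edge n) → (Fin n → Bool) → Vec Bool n →
     Fin n → Fin n → Set
E2 G M1 s0 σ u v =
  T (adj G u v) × Covered M1 u × ¬ Covered M1 v ×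
  side M1 s0 σ u ≢ side M1 s0 σ v

InE2 : ∀ {n} → Graph n → List (Edge n) → (Fin n → Bool) → Vec Bool n →
       Edge n → Set
InE2 G M1 s0 σ (u , v) = E2 G M1 s0 σ u v ⊎ E2 G M1 s0 σ v u

cap : ∀ {n} → List (Edge n) → ℕ → Fin n → ℕ
cap M1 b v = if coveredᵇ M1 v then 1 else b

IsMaximalBMatching : ∀ {n} → Graph n → List (Edge n) → (Fin n → Bool) →
                     ℕ → Vec Bool n → List (Edge n) → Set
IsMaximalBMatching G M1 s0 b σ M2 =
  (∀ {e} → e ∈ M2 → InE2 G M1 s0 σ e) ×
  (∀ v → deg M2 v ≤ cap M1 b v) ×
  (∀ u v → E2 G M1 s0 σ u v →
     cap M1 b u ≤ deg M2 u ⊎ cap M1 b v ≤ deg M2 v)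

record Path4 (n : ℕ) : Set where
  constructor path
  field
    u' u v v' : Fin n

open Path4 public

InM1∪M2 : ∀ {n} → List (Edge n) → List (Edge n) → Fin n → Fin n → Set
InM1∪M2 M1 M2 x y = InList M1 x y ⊎ InList M2 x y

Is3AugIn : ∀ {n} → List (Edge n) → List (Edge n) → Path4 n → Set
Is3AugIn M1 M2 p =
  InList M1 (u p) (v p) ×
  ¬ Covered M1 (u' p) × ¬ Covered M1 (v' p) × u' p ≢ v' p ×
  InM1∪M2 M1 M2 (u' p) (u p) × InM1∪M2 M1 M2 (v p) (v' p)

M1Disjoint : ∀ {n} → Path4 n → Path4 n → Set
M1Disjoint p q =
  u p ≢ u q × u p ≢ v q × v p ≢ u q × v p ≢ v q

ValidPathSet : ∀ {n} → List (Edge n) → List (Edge n) → List (Path4 n) → Set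
ValidPathSet M1 M2 P =
  (∀ {p} → p ∈ P → Is3AugIn M1 M2 p) × AllPairs M1Disjoint P

allVecs : (n : ℕ) → List (Vec Bool n)
allVecs zero = [] ∷ []
allVecs (suc n) = map (true ∷_) (allVecs n) ++ map (false ∷_) (allVecs n)

sumℚ : List ℚ → ℚ
sumℚ [] = 0ℚ
sumℚ (x ∷ xs) = x ℚ.+ sumℚ xs

Expect : (n : ℕ) → (Vec Bool n → ℕ) → ℚ
Expect n f =
  sumℚ (map (λ σ → ℕtoℚ (f σ)) (allVecs n)) ℚ.* ((+ 1 / (2 ^ n)) {{m^n≢0 2 n}})

-- Let M* be a maximum matching and D the deleted vertices, M1 being maximal in G − D. Every edge of M*
-- meets V(M1) ∪ D, and charging the edges of M* to their endpoints gives 2μ ≤ 3|M1| + 2|D| + k, where k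
-- counts the edges xy of M1 whose M*-partners x′, y′ both exist and are free, i.e. x′-x-y-y′ is
-- 3-augmenting. Since x′ ≠ y′ are free, their sides are independent fair coins, and with probability 1/4
-- both land opposite to x and y. Then either x and y both have M2-partners, which yields a path of P, or,
-- say, x has none; the E2-edge x x′ could then be added, so maximality makes x′ saturated by b edges of M2.
-- Every M2-edge has exactly one endpoint in V(M1), of capacity 1, so at most 2|M1|/b vertices are
-- saturated, each the M*-partner of a single vertex. Hence E|P| ≥ k/4 − 2|M1|/b, and the bound follows
-- from |M1| = (1/2 + c)μ and |D| ≤ εμ/4.

module Submission where

open import Defs hiding (sym)
open import Data.Nat using (ℕ; zero; suc; _+_; _*_; _∸_; _≤_; _^_; z≤n; s≤s; _≤ᵇ_; NonZero)
open import Data.Nat.Properties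
  using (+-*-semiring; +-identityʳ; *-identityʳ; *-identityˡ; *-zeroʳ; *-distribˡ-+; +-assoc; +-comm; *-comm;
         ≤-refl; ≤-reflexive; ≤-trans; ≤-antisym; +-mono-≤; +-monoʳ-≤; *-monoˡ-≤; *-monoʳ-≤; m≤m+n; m≤n+m; 1+n≰n;
         ≤ᵇ⇒≤; ≤⇒≤ᵇ; m+[n∸m]≡n; m^n≢0; module ≤-Reasoning)
open import Data.Bool.Properties using (∨-zeroʳ; ∧-zeroʳ; T-∨; T-≡; ¬-not; not-injective)
open import Function.Bundles using (Equivalence)
open import Data.Nat.Solver using (module +-*-Solver)
open import Data.Bool using (Bool; true; false; T; not; _∨_; _∧_; _xor_; if_then_else_)
open import Data.Fin using (Fin; _≟_) renaming (zero to fzero; suc to fsuc)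
open import Data.Vec using (Vec; _∷_; lookup)
open import Data.List using (List; []; _∷_; length; map; _++_)
open import Data.List.Membership.Propositional using (_∈_)
open import Data.List.Relation.Unary.Any using (here; there)
open import Data.Product using (Σ; _×_; _,_; proj₁; proj₂)
import Data.Product
open import Data.List.Relation.Unary.AllPairs using (AllPairs; []; _∷_)
import Data.List.Relation.Unary.All as All
open import Data.Sum using (_⊎_; inj₁; inj₂)
import Data.Sum
open import Data.Maybe using (Maybe; just; nothing; maybe′; is-just)
open import Data.Empty using (⊥-elim)
open import Relation.Nullary using (¬_; yes; no; does)
open import Relation.Nullary.Decidable using (⌊_⌋)
open import Relation.Binary.PropositionalEquality
open import Function using (_∘_)
open import Algebra.Properties.Semiring.Sum +-*-semiring
  using (sum-syntax; ∑-distrib-+; sum-cong-≗; sum-replicate-zero; *-distribˡ-sum)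
import Data.Integer as ℤ
import Data.Integer.Properties as ℤₚ
import Data.Integer.Solver as ℤ-Solver
import Data.Rational as ℚ
open ℚ using (ℚ; 0ℚ; 1ℚ; ½; _/_)
import Data.Rational.Properties as ℚₚ
import Data.Rational.Unnormalised as ℚᵘ
import Data.Rational.Unnormalised.Properties as ℚᵘₚ
import Data.Rational.Solver as ℚ-Solver

𝟙 : Bool → ℕ
𝟙 true  = 1
𝟙 false = 0

𝟙≤1 : ∀ b → 𝟙 b ≤ 1
𝟙≤1 true  = s≤s z≤n
𝟙≤1 false = z≤n

𝟙-∨ : ∀ a b → 𝟙 (a ∨ b) ≤ 𝟙 a + 𝟙 b
𝟙-∨ true  b = s≤s z≤n
𝟙-∨ false b = ≤-refl

charge-bound : ∀ cx cy dx dy → (T cx ⊎ T cy) ⊎ (T dx ⊎ T dy) →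
               2 ≤ (𝟙 cx + 𝟙 cx * 𝟙 (not cy) + 2 * 𝟙 dx) + (𝟙 cy + 𝟙 cy * 𝟙 (not cx) + 2 * 𝟙 dy)
charge-bound true  true  _     _     _ = +-mono-≤ {1} {_} {1} (s≤s z≤n) (s≤s z≤n)
charge-bound true  false dx    dy    _ = ≤-trans (s≤s (s≤s z≤n)) (m≤m+n (2 + 2 * 𝟙 dx) (2 * 𝟙 dy))
charge-bound false true  dx    dy    _ = ≤-trans (s≤s (s≤s z≤n)) (m≤n+m (2 + 2 * 𝟙 dy) (2 * 𝟙 dx))
charge-bound false false true  dy    _ = m≤m+n 2 (2 * 𝟙 dy)
charge-bound false false false true  _ = s≤s (s≤s z≤n)
charge-bound false false false false (inj₁ (inj₁ ()))
charge-bound false false false false (inj₁ (inj₂ ()))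
charge-bound false false false false (inj₂ (inj₁ ()))
charge-bound false false false false (inj₂ (inj₂ ()))

𝟙-xor-∧-total : ∀ s t → 𝟙 ((s xor true)  ∧ (t xor true))  + 𝟙 ((s xor true)  ∧ (t xor false)) +
                        (𝟙 ((s xor false) ∧ (t xor true))  + 𝟙 ((s xor false) ∧ (t xor false))) ≡ 1
𝟙-xor-∧-total true  true  = refl
𝟙-xor-∧-total true  false = refl
𝟙-xor-∧-total false true  = refl
𝟙-xor-∧-total false false = refl

*0≤ : ∀ m {k} → m * 0 ≤ k
*0≤ m = ≤-trans (≤-reflexive (*-zeroʳ m)) z≤n

𝟙+𝟙≤1+𝟙∧ : ∀ a b → 𝟙 a + 𝟙 b ≤ 1 + 𝟙 (a ∧ b)
𝟙+𝟙≤1+𝟙∧ true  true  = ≤-refl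
𝟙+𝟙≤1+𝟙∧ true  false = s≤s z≤n
𝟙+𝟙≤1+𝟙∧ false b     = 𝟙≤1 b

𝟙∧≤matched+stranded : ∀ gx gy mx my →
                      𝟙 (gx ∧ gy) ≤ 𝟙 (mx ∧ my) + (𝟙 (not mx ∧ gx) + 𝟙 (not my ∧ gy))
𝟙∧≤matched+stranded false _     _     _     = z≤n
𝟙∧≤matched+stranded true  false _     _     = z≤n
𝟙∧≤matched+stranded true  true  true  true  = s≤s z≤n
𝟙∧≤matched+stranded true  true  true  false = s≤s z≤n
𝟙∧≤matched+stranded true  true  false _     = s≤s z≤n

𝟙-not-+-swap : ∀ a b → (T a × ¬ T b) ⊎ (T b × ¬ T a) → 𝟙 (not a) + 𝟙 (not b) ≡ 𝟙 a + 𝟙 b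
𝟙-not-+-swap true  false _                  = refl
𝟙-not-+-swap false true  _                  = refl
𝟙-not-+-swap true  true  (inj₁ (_ , ¬tt))   = ⊥-elim (¬tt _)
𝟙-not-+-swap true  true  (inj₂ (_ , ¬tt))   = ⊥-elim (¬tt _)
𝟙-not-+-swap false false (inj₁ (() , _))
𝟙-not-+-swap false false (inj₂ (() , _))

xor≡true⇒≢ : ∀ a b → a xor b ≡ true → a ≢ b
xor≡true⇒≢ true  true  () refl
xor≡true⇒≢ false false () refl

-- Finite sums

∑-mono-≤ : ∀ {n} {f g : Fin n → ℕ} → (∀ v → f v ≤ g v) → ∑[ v < n ] f v ≤ ∑[ v < n ] g v
∑-mono-≤ {zero}  f≤g = z≤n
∑-mono-≤ {suc n} f≤g = +-mono-≤ (f≤g fzero) (∑-mono-≤ (f≤g ∘ fsuc))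

∑-δ : ∀ {n} (x : Fin n) (g : Fin n → ℕ) → ∑[ v < n ] (𝟙 (does (x ≟ v)) * g v) ≡ g x
∑-δ {suc n} fzero    g = trans (cong₂ _+_ (+-identityʳ (g fzero)) (sum-replicate-zero n)) (+-identityʳ (g fzero))
∑-δ {suc n} (fsuc x) g = ∑-δ x (g ∘ fsuc)

sumOver : {A : Set} → List A → (A → ℕ) → ℕ
sumOver []       f = 0
sumOver (x ∷ xs) f = f x + sumOver xs f

infixl 10 sumOver
syntax sumOver xs (λ x → e) = ∑[ x ← xs ] e

private
  variable
    A B : Set

sumOver-cong : ∀ (xs : List A) {f g : A → ℕ} → (∀ {x} → x ∈ xs → f x ≡ g x) →
               ∑[ x ← xs ] f x ≡ ∑[ x ← xs ] g x
sumOver-cong []       f≡g = refl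
sumOver-cong (x ∷ xs) f≡g = cong₂ _+_ (f≡g (here refl)) (sumOver-cong xs (f≡g ∘ there))

sumOver-mono-≤ : ∀ (xs : List A) {f g : A → ℕ} → (∀ {x} → x ∈ xs → f x ≤ g x) →
                 ∑[ x ← xs ] f x ≤ ∑[ x ← xs ] g x
sumOver-mono-≤ []       f≤g = z≤n
sumOver-mono-≤ (x ∷ xs) f≤g = +-mono-≤ (f≤g (here refl)) (sumOver-mono-≤ xs (f≤g ∘ there))

sumOver-distrib-+ : ∀ (xs : List A) (f g : A → ℕ) →
                    ∑[ x ← xs ] (f x + g x) ≡ ∑[ x ← xs ] f x + ∑[ x ← xs ] g x
sumOver-distrib-+ []       f g = refl
sumOver-distrib-+ (x ∷ xs) f g = begin
  f x + g x + ∑[ y ← xs ] (f y + g y)   ≡⟨ cong (f x + g x +_) (sumOver-distrib-+ xs f g) ⟩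
  f x + g x + (F + G)                   ≡⟨ solve 4 (λ a b c d → a :+ b :+ (c :+ d) := a :+ c :+ (b :+ d)) refl (f x) (g x) F G ⟩
  f x + F + (g x + G)                   ∎
  where
  open ≡-Reasoning
  open +-*-Solver
  F G : ℕ
  F = ∑[ y ← xs ] f y
  G = ∑[ y ← xs ] g y

sumOver-distribˡ-* : ∀ (xs : List A) k (f : A → ℕ) → ∑[ x ← xs ] (k * f x) ≡ k * ∑[ x ← xs ] f x
sumOver-distribˡ-* []       k f = sym (*-zeroʳ k)
sumOver-distribˡ-* (x ∷ xs) k f =
  trans (cong (k * f x +_) (sumOver-distribˡ-* xs k f)) (sym (*-distribˡ-+ k (f x) _))

sumOver-const : ∀ (xs : List A) k → ∑[ x ← xs ] k ≡ length xs * k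
sumOver-const []       k = refl
sumOver-const (x ∷ xs) k = cong (k +_) (sumOver-const xs k)

sumOver-++ : ∀ (xs ys : List A) (f : A → ℕ) → sumOver (xs ++ ys) f ≡ sumOver xs f + sumOver ys f
sumOver-++ []       ys f = refl
sumOver-++ (x ∷ xs) ys f = trans (cong (f x +_) (sumOver-++ xs ys f)) (sym (+-assoc (f x) _ _))

sumOver-map : ∀ (xs : List B) (h : B → A) (f : A → ℕ) → sumOver (map h xs) f ≡ ∑[ x ← xs ] f (h x)
sumOver-map []       h f = refl
sumOver-map (x ∷ xs) h f = cong (f (h x) +_) (sumOver-map xs h f)

sumOver-comm : ∀ (xs : List A) (ys : List B) (f : A → B → ℕ) →
               ∑[ x ← xs ] (∑[ y ← ys ] f x y) ≡ ∑[ y ← ys ] (∑[ x ← xs ] f x y)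
sumOver-comm []       ys f = sym (trans (sumOver-const ys 0) (*-zeroʳ (length ys)))
sumOver-comm (x ∷ xs) ys f =
  trans (cong (sumOver ys (f x) +_) (sumOver-comm xs ys f)) (sym (sumOver-distrib-+ ys (f x) _))

-- Degrees and partners in lists of edges

Loopless : ∀ {n} → List (Edge n) → Set
Loopless L = ∀ {x y} → (x , y) ∈ L → x ≢ y

bothEnds : ∀ {n} → (Fin n → ℕ) → Edge n → ℕ
bothEnds g (x , y) = g x + g y

bothᵇ : ∀ {n} → (Fin n → Bool) → Edge n → Bool
bothᵇ p (x , y) = p x ∧ p y

module _ {n : ℕ} where

  open import Data.List.Membership.DecPropositional (_≟_ {n}) using (_∈?_)

  deg-∷ : ∀ (e : Edge n) L v → deg (e ∷ L) v ≡ 𝟙 (isEnd v e) + deg L v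
  deg-∷ e L v with isEnd v e
  ... | true  = refl
  ... | false = refl

  𝟙-isEnd : ∀ {x y : Fin n} v → x ≢ y → 𝟙 (isEnd v (x , y)) ≡ 𝟙 (does (x ≟ v)) + 𝟙 (does (y ≟ v))
  𝟙-isEnd {x} {y} v x≢y with x ≟ v | y ≟ v
  ... | yes refl | yes refl = ⊥-elim (x≢y refl)
  ... | yes _    | no _     = refl
  ... | no _     | yes _    = refl
  ... | no _     | no _     = refl

  handshake : ∀ (L : List (Edge n)) (g : Fin n → ℕ) → Loopless L →
           ∑[ v < n ] (deg L v * g v) ≡ ∑[ e ← L ] bothEnds g e
  handshake []            g _        = sum-replicate-zero n
  handshake ((x , y) ∷ L) g loopless = begin
    ∑[ v < n ] (deg ((x , y) ∷ L) v * g v)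
      ≡⟨ sum-cong-≗ split ⟩
    ∑[ v < n ] (𝟙 (does (x ≟ v)) * g v + 𝟙 (does (y ≟ v)) * g v + deg L v * g v)
      ≡⟨ ∑-distrib-+ (λ v → 𝟙 (does (x ≟ v)) * g v + 𝟙 (does (y ≟ v)) * g v) (λ v → deg L v * g v) ⟩
    ∑[ v < n ] (𝟙 (does (x ≟ v)) * g v + 𝟙 (does (y ≟ v)) * g v) + ∑[ v < n ] (deg L v * g v)
      ≡⟨ cong₂ _+_ (trans (∑-distrib-+ (λ v → 𝟙 (does (x ≟ v)) * g v) (λ v → 𝟙 (does (y ≟ v)) * g v))
                          (cong₂ _+_ (∑-δ x g) (∑-δ y g)))
                   (handshake L g (loopless ∘ there)) ⟩
    g x + g y + ∑[ e ← L ] bothEnds g e ∎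
    where
    open ≡-Reasoning
    split : ∀ v → deg ((x , y) ∷ L) v * g v ≡ 𝟙 (does (x ≟ v)) * g v + 𝟙 (does (y ≟ v)) * g v + deg L v * g v
    split v = begin
      deg ((x , y) ∷ L) v * g v
        ≡⟨ cong (_* g v) (trans (deg-∷ (x , y) L v) (cong (_+ deg L v) (𝟙-isEnd v (loopless (here refl))))) ⟩
      (𝟙 (does (x ≟ v)) + 𝟙 (does (y ≟ v)) + deg L v) * g v
        ≡⟨ solve 4 (λ a b c g → (a :+ b :+ c) :* g := a :* g :+ b :* g :+ c :* g) refl
                   (𝟙 (does (x ≟ v))) (𝟙 (does (y ≟ v))) (deg L v) (g v) ⟩
      𝟙 (does (x ≟ v)) * g v + 𝟙 (does (y ≟ v)) * g v + deg L v * g v ∎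
      where open +-*-Solver

  isEnd-fst : ∀ (x y : Fin n) → T (isEnd x (x , y))
  isEnd-fst x y with x ≟ x
  ... | yes _   = _
  ... | no x≢x  = ⊥-elim (x≢x refl)

  isEnd-snd : ∀ (x y : Fin n) → T (isEnd y (x , y))
  isEnd-snd x y with y ≟ y
  ... | yes _   = subst T (sym (∨-zeroʳ ⌊ x ≟ y ⌋)) _
  ... | no y≢y  = ⊥-elim (y≢y refl)

  ∈⇒1≤deg : ∀ {L : List (Edge n)} {e} v → e ∈ L → T (isEnd v e) → 1 ≤ deg L v
  ∈⇒1≤deg {e ∷ L} v (here refl) v∈e rewrite deg-∷ e L v | T-≡ .Equivalence.to v∈e = s≤s z≤n
  ∈⇒1≤deg {e ∷ L} v (there e∈L) v∈e rewrite deg-∷ e L v = ≤-trans (∈⇒1≤deg v e∈L v∈e) (m≤n+m _ _)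

  ∈⇒Covered : ∀ {L : List (Edge n)} {e} v → e ∈ L → T (isEnd v e) → Covered L v
  ∈⇒Covered {e ∷ L} v (here refl) v∈e = T-∨ .Equivalence.from (inj₁ v∈e)
  ∈⇒Covered {e ∷ L} v (there e∈L) v∈e = T-∨ .Equivalence.from (inj₂ (∈⇒Covered v e∈L v∈e))

  𝟙-covered≤deg : ∀ (L : List (Edge n)) v → 𝟙 (coveredᵇ L v) ≤ deg L v
  𝟙-covered≤deg []      v = z≤n
  𝟙-covered≤deg (e ∷ L) v = begin
    𝟙 (isEnd v e ∨ coveredᵇ L v)      ≤⟨ 𝟙-∨ (isEnd v e) (coveredᵇ L v) ⟩
    𝟙 (isEnd v e) + 𝟙 (coveredᵇ L v)  ≤⟨ +-monoʳ-≤ (𝟙 (isEnd v e)) (𝟙-covered≤deg L v) ⟩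
    𝟙 (isEnd v e) + deg L v           ≡⟨ deg-∷ e L v ⟨
    deg (e ∷ L) v                     ∎
    where open ≤-Reasoning

  uncovered⇒deg≡0 : ∀ (L : List (Edge n)) v → ¬ Covered L v → deg L v ≡ 0
  uncovered⇒deg≡0 []      v _ = refl
  uncovered⇒deg≡0 (e ∷ L) v v∉L with isEnd v e
  ... | true  = ⊥-elim (v∉L _)
  ... | false = uncovered⇒deg≡0 L v v∉L

  deg≤1⇒∉tail : ∀ {e} {L : List (Edge n)} w → deg (e ∷ L) w ≤ 1 → T (isEnd w e) →
                ∀ {e′} → e′ ∈ L → ¬ T (isEnd w e′)
  deg≤1⇒∉tail {e} {L} w d w∈e e′∈L w∈e′ rewrite deg-∷ e L w | T-≡ .Equivalence.to w∈e =
    1+n≰n (≤-trans (s≤s (∈⇒1≤deg w e′∈L w∈e′)) d)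

  deg-tail≤ : ∀ (e : Edge n) L v → deg L v ≤ deg (e ∷ L) v
  deg-tail≤ e L v = ≤-trans (m≤n+m (deg L v) _) (≤-reflexive (sym (deg-∷ e L v)))

  deg≤1⇒unique : ∀ {L : List (Edge n)} {e e′} w → deg L w ≤ 1 → e ∈ L → e′ ∈ L →
                 T (isEnd w e) → T (isEnd w e′) → e ≡ e′
  deg≤1⇒unique         w d (here refl) (here refl)  _   _    = refl
  deg≤1⇒unique {e ∷ L} w d (here refl) (there e′∈L) w∈e w∈e′ = ⊥-elim (deg≤1⇒∉tail {e} {L} w d w∈e e′∈L w∈e′)
  deg≤1⇒unique {e ∷ L} w d (there e∈L) (here refl)  w∈e w∈e′ = ⊥-elim (deg≤1⇒∉tail {e} {L} w d w∈e′ e∈L w∈e)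
  deg≤1⇒unique {e″ ∷ L} w d (there e∈L) (there e′∈L) w∈e w∈e′ =
    deg≤1⇒unique w (≤-trans (deg-tail≤ e″ L w) d) e∈L e′∈L w∈e w∈e′

  ∑-deg*≤∑ : ∀ (L : List (Edge n)) (g : Fin n → ℕ) → (∀ v → deg L v ≤ 1) →
            ∑[ v < n ] (deg L v * g v) ≤ ∑[ v < n ] g v
  ∑-deg*≤∑ L g deg≤1 = ∑-mono-≤ λ v → ≤-trans (*-monoˡ-≤ (g v) (deg≤1 v)) (≤-reflexive (+-identityʳ (g v)))

  ∑-covered≤2*length : ∀ (L : List (Edge n)) → Loopless L → ∑[ v < n ] 𝟙 (coveredᵇ L v) ≤ 2 * length L
  ∑-covered≤2*length L loopless = begin
    ∑[ v < n ] 𝟙 (coveredᵇ L v)   ≤⟨ ∑-mono-≤ (λ v → ≤-trans (𝟙-covered≤deg L v) (≤-reflexive (sym (*-identityʳ (deg L v))))) ⟩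
    ∑[ v < n ] (deg L v * 1)      ≡⟨ handshake L (λ _ → 1) loopless ⟩
    ∑[ e ← L ] 2                  ≡⟨ sumOver-const L 2 ⟩
    length L * 2                  ≡⟨ *-comm (length L) 2 ⟩
    2 * length L                  ∎
    where open ≤-Reasoning

  ∑-∈?≤length : ∀ (D : List (Fin n)) → ∑[ v < n ] 𝟙 (does (v ∈? D)) ≤ length D
  ∑-∈?≤length []      = ≤-reflexive (sum-replicate-zero n)
  ∑-∈?≤length (d ∷ D) = begin
    ∑[ v < n ] 𝟙 (does (v ∈? (d ∷ D)))                                 ≤⟨ ∑-mono-≤ head-or-tail ⟩
    ∑[ v < n ] (𝟙 (does (d ≟ v)) * 1 + 𝟙 (does (v ∈? D)))              ≡⟨ ∑-distrib-+ (λ v → 𝟙 (does (d ≟ v)) * 1) _ ⟩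
    ∑[ v < n ] (𝟙 (does (d ≟ v)) * 1) + ∑[ v < n ] 𝟙 (does (v ∈? D))   ≤⟨ +-mono-≤ (≤-reflexive (∑-δ d (λ _ → 1))) (∑-∈?≤length D) ⟩
    1 + length D                                                       ∎
    where
    open ≤-Reasoning
    head-or-tail : ∀ v → 𝟙 (does (v ∈? (d ∷ D))) ≤ 𝟙 (does (d ≟ v)) * 1 + 𝟙 (does (v ∈? D))
    head-or-tail v with v ≟ d | d ≟ v
    ... | yes refl | yes _   = s≤s z≤n
    ... | yes refl | no d≢d  = ⊥-elim (d≢d refl)
    ... | no _     | _       = m≤n+m _ _

partner : ∀ {n} → List (Edge n) → Fin n → Maybe (Fin n)
partner []            v = nothing
partner ((x , y) ∷ L) v = if does (x ≟ v) then just y else if does (y ≟ v) then just x else partner L v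

IsMatchingList : ∀ {n} → List (Edge n) → Set
IsMatchingList {n} L = Loopless L × (∀ (v : Fin n) → deg L v ≤ 1)

module _ {n : ℕ} where

  InList-swap : ∀ {L : List (Edge n)} {x y} → InList L x y → InList L y x
  InList-swap (inj₁ xy∈L) = inj₂ xy∈L
  InList-swap (inj₂ yx∈L) = inj₁ yx∈L

  InList⇒1≤deg : ∀ {L : List (Edge n)} {x y} → InList L x y → 1 ≤ deg L x
  InList⇒1≤deg {x = x} {y} (inj₁ xy∈L) = ∈⇒1≤deg x xy∈L (isEnd-fst x y)
  InList⇒1≤deg {x = x} {y} (inj₂ yx∈L) = ∈⇒1≤deg x yx∈L (isEnd-snd y x)

  partner-InList : ∀ (L : List (Edge n)) v {w} → partner L v ≡ just w → InList L v w
  partner-InList ((x , y) ∷ L) v eq with x ≟ v | y ≟ v | eq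
  ... | yes refl | _        | refl = inj₁ (here refl)
  ... | no _     | yes refl | refl = inj₂ (here refl)
  ... | no _     | no _     | eq′  = Data.Sum.map there there (partner-InList L v eq′)

  partner≡nothing⇒deg≡0 : ∀ (L : List (Edge n)) v → partner L v ≡ nothing → deg L v ≡ 0
  partner≡nothing⇒deg≡0 []            v _  = refl
  partner≡nothing⇒deg≡0 ((x , y) ∷ L) v eq with x ≟ v | y ≟ v | eq
  ... | yes refl | _        | ()
  ... | no _     | yes refl | ()
  ... | no _     | no _     | eq′  = partner≡nothing⇒deg≡0 L v eq′

  neighbour-unique : ∀ {L : List (Edge n)} → IsMatchingList L → ∀ {x y z} → InList L x y → InList L x z → y ≡ z
  neighbour-unique {L} (loopless , deg≤1) {x} {y} {z} = cases
    where
    same : ∀ {e e′} → e ∈ L → e′ ∈ L → T (isEnd x e) → T (isEnd x e′) → e ≡ e′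
    same = deg≤1⇒unique x (deg≤1 x)
    cases : InList L x y → InList L x z → y ≡ z
    cases (inj₁ xy) (inj₁ xz) = cong proj₂ (same xy xz (isEnd-fst x y) (isEnd-fst x z))
    cases (inj₁ xy) (inj₂ zx) = ⊥-elim (loopless xy (sym (cong proj₂ (same xy zx (isEnd-fst x y) (isEnd-snd z x)))))
    cases (inj₂ yx) (inj₁ xz) = ⊥-elim (loopless yx (cong proj₁ (same yx xz (isEnd-snd y x) (isEnd-fst x z))))
    cases (inj₂ yx) (inj₂ zx) = cong proj₁ (same yx zx (isEnd-snd y x) (isEnd-snd z x))

  partner-of : ∀ {L : List (Edge n)} → IsMatchingList L → ∀ {x y} → InList L x y → partner L x ≡ just y
  partner-of {L} matching {x} xy with partner L x in eq
  ... | nothing = ⊥-elim (1+n≰n (≤-trans (InList⇒1≤deg xy) (≤-reflexive (partner≡nothing⇒deg≡0 L x eq))))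
  ... | just w  = cong just (neighbour-unique matching (partner-InList L x eq) xy)

  partner-injective : ∀ {L : List (Edge n)} → IsMatchingList L → ∀ {x y w} →
                      partner L x ≡ just w → partner L y ≡ just w → x ≡ y
  partner-injective {L} matching {x} {y} {w} xw yw =
    neighbour-unique matching (InList-swap (partner-InList L x xw)) (InList-swap (partner-InList L y yw))

  ∑-partner : ∀ {L : List (Edge n)} → IsMatchingList L → (g : Fin n → ℕ) →
              ∑[ v < n ] maybe′ g 0 (partner L v) ≡ ∑[ v < n ] (deg L v * g v)
  ∑-partner {L} matching@(loopless , deg≤1) g = begin
    ∑[ v < n ] g′ v                   ≡⟨ sum-cong-≗ weighted ⟩
    ∑[ v < n ] (deg L v * g′ v)       ≡⟨ handshake L g′ loopless ⟩
    ∑[ e ← L ] bothEnds g′ e          ≡⟨ sumOver-cong L across ⟩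
    ∑[ e ← L ] bothEnds g e           ≡⟨ handshake L g loopless ⟨
    ∑[ v < n ] (deg L v * g v)        ∎
    where
    open ≡-Reasoning
    g′ : Fin n → ℕ
    g′ v = maybe′ g 0 (partner L v)
    weighted : ∀ v → g′ v ≡ deg L v * g′ v
    weighted v with partner L v in eq
    ... | nothing = sym (*-zeroʳ (deg L v))
    ... | just w  = begin
      g w              ≡⟨ *-identityˡ (g w) ⟨
      1 * g w          ≡⟨ cong (_* g w) (≤-antisym (InList⇒1≤deg (partner-InList L v eq)) (deg≤1 v)) ⟩
      deg L v * g w    ∎
    across : ∀ {e} → e ∈ L → bothEnds g′ e ≡ bothEnds g e
    across {x , y} xy∈L
      rewrite partner-of matching (inj₁ xy∈L) | partner-of matching (inj₂ xy∈L) = +-comm (g y) (g x)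

-- Uniform random sign vectors

∑-allVecs-suc : ∀ n (f : Vec Bool (suc n) → ℕ) →
                ∑[ σ ← allVecs (suc n) ] f σ ≡ ∑[ σ ← allVecs n ] f (true ∷ σ) + ∑[ σ ← allVecs n ] f (false ∷ σ)
∑-allVecs-suc n f = trans (sumOver-++ (map (true ∷_) (allVecs n)) _ f)
                         (cong₂ _+_ (sumOver-map (allVecs n) (true ∷_) f) (sumOver-map (allVecs n) (false ∷_) f))

∑-allVecs-const : ∀ n k → ∑[ σ ← allVecs n ] k ≡ 2 ^ n * k
∑-allVecs-const zero    k = refl
∑-allVecs-const (suc n) k = begin
  ∑[ σ ← allVecs (suc n) ] k                      ≡⟨ ∑-allVecs-suc n (λ _ → k) ⟩
  ∑[ σ ← allVecs n ] k + ∑[ σ ← allVecs n ] k     ≡⟨ cong₂ _+_ (∑-allVecs-const n k) (∑-allVecs-const n k) ⟩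
  2 ^ n * k + 2 ^ n * k                           ≡⟨ solve 2 (λ N k → N :* k :+ N :* k := (con 2 :* N) :* k) refl (2 ^ n) k ⟩
  2 ^ suc n * k                                   ∎
  where open ≡-Reasoning; open +-*-Solver

∑-allVecs-vanish : ∀ n {f : Vec Bool n → ℕ} {r} → (∀ σ → f σ ≡ 0) → r ≡ 0 →
                   4 * ∑[ σ ← allVecs n ] f σ ≡ 2 ^ n * r
∑-allVecs-vanish n {f} {r} f≡0 r≡0 = begin
  4 * ∑[ σ ← allVecs n ] f σ  ≡⟨ cong (4 *_) (sumOver-cong (allVecs n) (λ {σ} _ → f≡0 σ)) ⟩
  4 * ∑[ σ ← allVecs n ] 0    ≡⟨ cong (4 *_) (trans (∑-allVecs-const n 0) (*-zeroʳ (2 ^ n))) ⟩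
  0                           ≡⟨ trans (cong (2 ^ n *_) r≡0) (*-zeroʳ (2 ^ n)) ⟨
  2 ^ n * r                   ∎
  where open ≡-Reasoning

∑-allVecs-lookup : ∀ n (w : Fin n) (h : Bool → ℕ) →
                   2 * ∑[ σ ← allVecs n ] h (lookup σ w) ≡ 2 ^ n * (h true + h false)
∑-allVecs-lookup (suc n) fzero h = begin
  2 * ∑[ σ ← allVecs (suc n) ] h (lookup σ fzero)               ≡⟨ cong (2 *_) (∑-allVecs-suc n _) ⟩
  2 * (∑[ σ ← allVecs n ] h true + ∑[ σ ← allVecs n ] h false) ≡⟨ cong (2 *_) (cong₂ _+_ (∑-allVecs-const n _) (∑-allVecs-const n _)) ⟩
  2 * (2 ^ n * h true + 2 ^ n * h false)                        ≡⟨ solve 3 (λ N a b → con 2 :* (N :* a :+ N :* b) := (con 2 :* N) :* (a :+ b))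
                                                                           refl (2 ^ n) (h true) (h false) ⟩
  2 ^ suc n * (h true + h false)                                ∎
  where open ≡-Reasoning; open +-*-Solver
∑-allVecs-lookup (suc n) (fsuc w) h = begin
  2 * ∑[ σ ← allVecs (suc n) ] h (lookup σ (fsuc w)) ≡⟨ cong (2 *_) (∑-allVecs-suc n _) ⟩
  2 * (S + S)                       ≡⟨ *-distribˡ-+ 2 S S ⟩
  2 * S + 2 * S                     ≡⟨ cong₂ _+_ (∑-allVecs-lookup n w h) (∑-allVecs-lookup n w h) ⟩
  2 ^ n * H + 2 ^ n * H             ≡⟨ solve 2 (λ N H → N :* H :+ N :* H := (con 2 :* N) :* H) refl (2 ^ n) H ⟩
  2 ^ suc n * H                     ∎
  where
  open ≡-Reasoning; open +-*-Solver
  S H : ℕ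
  S = ∑[ σ ← allVecs n ] h (lookup σ w)
  H = h true + h false

∑-allVecs-lookup₂ : ∀ n {w w′ : Fin n} → w ≢ w′ → (h : Bool → Bool → ℕ) →
                    4 * ∑[ σ ← allVecs n ] h (lookup σ w) (lookup σ w′)
                      ≡ 2 ^ n * (h true true + h true false + (h false true + h false false))
∑-allVecs-lookup₂ (suc n) {fzero} {fzero} w≢w′ h = ⊥-elim (w≢w′ refl)
∑-allVecs-lookup₂ (suc n) {fzero} {fsuc j} _ h = begin
  4 * ∑[ σ ← allVecs (suc n) ] h (lookup σ fzero) (lookup σ (fsuc j))
    ≡⟨ cong (4 *_) (∑-allVecs-suc n _) ⟩
  4 * (P + Q)
    ≡⟨ solve 2 (λ P Q → con 4 :* (P :+ Q) := con 2 :* (con 2 :* P :+ con 2 :* Q)) refl P Q ⟩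
  2 * (2 * P + 2 * Q)
    ≡⟨ cong (2 *_) (cong₂ _+_ (∑-allVecs-lookup n j (h true)) (∑-allVecs-lookup n j (h false))) ⟩
  2 * (2 ^ n * (htt + htf) + 2 ^ n * (hft + hff))
    ≡⟨ solve 5 (λ N a b c d → con 2 :* (N :* (a :+ b) :+ N :* (c :+ d)) := (con 2 :* N) :* (a :+ b :+ (c :+ d)))
               refl (2 ^ n) htt htf hft hff ⟩
  2 ^ suc n * (htt + htf + (hft + hff))           ∎
  where
  open ≡-Reasoning; open +-*-Solver
  P Q htt htf hft hff : ℕ
  P = ∑[ σ ← allVecs n ] h true (lookup σ j)
  Q = ∑[ σ ← allVecs n ] h false (lookup σ j)
  htt = h true true; htf = h true false; hft = h false true; hff = h false false
∑-allVecs-lookup₂ (suc n) {fsuc i} {fzero} _ h = begin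
  4 * ∑[ σ ← allVecs (suc n) ] h (lookup σ (fsuc i)) (lookup σ fzero)
    ≡⟨ cong (4 *_) (∑-allVecs-suc n _) ⟩
  4 * (P + Q)
    ≡⟨ solve 2 (λ P Q → con 4 :* (P :+ Q) := con 2 :* (con 2 :* P :+ con 2 :* Q)) refl P Q ⟩
  2 * (2 * P + 2 * Q)
    ≡⟨ cong (2 *_) (cong₂ _+_ (∑-allVecs-lookup n i (λ a → h a true)) (∑-allVecs-lookup n i (λ a → h a false))) ⟩
  2 * (2 ^ n * (htt + hft) + 2 ^ n * (htf + hff))
    ≡⟨ solve 5 (λ N a b c d → con 2 :* (N :* (a :+ c) :+ N :* (b :+ d)) := (con 2 :* N) :* (a :+ b :+ (c :+ d)))
               refl (2 ^ n) htt htf hft hff ⟩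
  2 ^ suc n * (htt + htf + (hft + hff))           ∎
  where
  open ≡-Reasoning; open +-*-Solver
  P Q htt htf hft hff : ℕ
  P = ∑[ σ ← allVecs n ] h (lookup σ i) true
  Q = ∑[ σ ← allVecs n ] h (lookup σ i) false
  htt = h true true; htf = h true false; hft = h false true; hff = h false false
∑-allVecs-lookup₂ (suc n) {fsuc i} {fsuc j} i≢j h = begin
  4 * ∑[ σ ← allVecs (suc n) ] h (lookup σ (fsuc i)) (lookup σ (fsuc j)) ≡⟨ cong (4 *_) (∑-allVecs-suc n _) ⟩
  4 * (S + S)                 ≡⟨ *-distribˡ-+ 4 S S ⟩
  4 * S + 4 * S               ≡⟨ cong₂ _+_ (∑-allVecs-lookup₂ n i≢j′ h) (∑-allVecs-lookup₂ n i≢j′ h) ⟩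
  2 ^ n * H + 2 ^ n * H       ≡⟨ solve 2 (λ N H → N :* H :+ N :* H := (con 2 :* N) :* H) refl (2 ^ n) H ⟩
  2 ^ suc n * H               ∎
  where
  open ≡-Reasoning; open +-*-Solver
  i≢j′ : i ≢ j
  i≢j′ = i≢j ∘ cong fsuc
  S H : ℕ
  S = ∑[ σ ← allVecs n ] h (lookup σ i) (lookup σ j)
  H = h true true + h true false + (h false true + h false false)

-- Matchings of a graph and paths through them

module _ {n : ℕ} (G : Graph n) where

  adj⇒≢ : ∀ {x y} → T (adj G x y) → x ≢ y
  adj⇒≢ {x} xy refl = subst T (irref G x) xy

  IsMatching⇒IsMatchingList : ∀ {M} → IsMatching G M → IsMatchingList M
  IsMatching⇒IsMatchingList (inG , deg≤1) = (λ xy∈M → adj⇒≢ (inG xy∈M)) , deg≤1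

pathsAlong : ∀ {n} → List (Edge n) → List (Edge n) → List (Path4 n)
pathsAlong M [] = []
pathsAlong M ((x , y) ∷ L) with partner M x | partner M y
... | just a | just a′ = path a x y a′ ∷ pathsAlong M L
... | _      | _       = pathsAlong M L

module _ {n : ℕ} (M : List (Edge n)) where

  isMatched : Fin n → Bool
  isMatched v = is-just (partner M v)

  length-pathsAlong : ∀ L → length (pathsAlong M L) ≡ ∑[ e ← L ] 𝟙 (bothᵇ isMatched e)
  length-pathsAlong []            = refl
  length-pathsAlong ((x , y) ∷ L) with partner M x | partner M y
  ... | just _  | just _  = cong suc (length-pathsAlong L)
  ... | just _  | nothing = length-pathsAlong L
  ... | nothing | _       = length-pathsAlong L

  ∈-pathsAlong : ∀ {L a x y a′} → path a x y a′ ∈ pathsAlong M L →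
                 (x , y) ∈ L × partner M x ≡ just a × partner M y ≡ just a′
  ∈-pathsAlong {(x , y) ∷ L} p∈ with partner M x in px | partner M y in py
  ∈-pathsAlong {(x , y) ∷ L} (here refl) | just _ | just _ = here refl , px , py
  ∈-pathsAlong {(x , y) ∷ L} (there p∈)  | just _ | just _ = Data.Product.map₁ there (∈-pathsAlong p∈)
  ∈-pathsAlong {(x , y) ∷ L} p∈ | just _  | nothing = Data.Product.map₁ there (∈-pathsAlong p∈)
  ∈-pathsAlong {(x , y) ∷ L} p∈ | nothing | _       = Data.Product.map₁ there (∈-pathsAlong p∈)

  pathsAlong-disjoint : ∀ L → (∀ v → deg L v ≤ 1) → AllPairs M1Disjoint (pathsAlong M L)
  pathsAlong-disjoint []            _     = []
  pathsAlong-disjoint ((x , y) ∷ L) deg≤1 with partner M x | partner M y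
  ... | just a  | just a′ = All.tabulate disjoint-from-head ∷ pathsAlong-disjoint L deg≤1-tail
    where
    deg≤1-tail : ∀ v → deg L v ≤ 1
    deg≤1-tail v = ≤-trans (deg-tail≤ (x , y) L v) (deg≤1 v)
    fresh : ∀ {w x′ y′} → T (isEnd w (x , y)) → (x′ , y′) ∈ L → w ≢ x′ × w ≢ y′
    fresh {w} {x′} {y′} w∈xy x′y′∈L =
      (λ { refl → deg≤1⇒∉tail {e = x , y} {L = L} w (deg≤1 w) w∈xy x′y′∈L (isEnd-fst x′ y′) }) ,
      (λ { refl → deg≤1⇒∉tail {e = x , y} {L = L} w (deg≤1 w) w∈xy x′y′∈L (isEnd-snd x′ y′) })
    disjoint-from-head : ∀ {q} → q ∈ pathsAlong M L → M1Disjoint (path a x y a′) q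
    disjoint-from-head {path b x′ y′ b′} q∈ with ∈-pathsAlong q∈
    ... | x′y′∈L , _ = let (x≢x′ , x≢y′) = fresh (isEnd-fst x y) x′y′∈L
                           (y≢x′ , y≢y′) = fresh (isEnd-snd x y) x′y′∈L
                       in x≢x′ , x≢y′ , y≢x′ , y≢y′
  ... | just _  | nothing = pathsAlong-disjoint L (λ v → ≤-trans (deg-tail≤ (x , y) L v) (deg≤1 v))
  ... | nothing | _       = pathsAlong-disjoint L (λ v → ≤-trans (deg-tail≤ (x , y) L v) (deg≤1 v))

-- Charging a maximum matching M* to M1 and the deleted vertices D

module _ {n : ℕ} (G : Graph n) (M* M1 : List (Edge n)) where

  open import Data.List.Membership.DecPropositional (_≟_ {n}) using (_∈?_)

  hasFreeMate : Fin n → Bool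
  hasFreeMate v = maybe′ (not ∘ coveredᵇ M1) false (partner M* v)

  ∑-covered*freeMate≤ : Loopless M1 →
    ∑[ v < n ] (𝟙 (coveredᵇ M1 v) * 𝟙 (hasFreeMate v)) ≤ length M1 + ∑[ e ← M1 ] 𝟙 (bothᵇ hasFreeMate e)
  ∑-covered*freeMate≤ loopless = begin
    ∑[ v < n ] (𝟙 (coveredᵇ M1 v) * f v)        ≤⟨ ∑-mono-≤ (λ v → *-monoˡ-≤ (f v) (𝟙-covered≤deg M1 v)) ⟩
    ∑[ v < n ] (deg M1 v * f v)                 ≡⟨ handshake M1 f loopless ⟩
    ∑[ e ← M1 ] bothEnds f e                    ≤⟨ sumOver-mono-≤ M1 (λ {(x , y)} _ → 𝟙+𝟙≤1+𝟙∧ (hasFreeMate x) (hasFreeMate y)) ⟩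
    ∑[ e ← M1 ] (1 + 𝟙 (bothᵇ hasFreeMate e))   ≡⟨ sumOver-distrib-+ M1 (λ _ → 1) _ ⟩
    ∑[ e ← M1 ] 1 + ∑[ e ← M1 ] 𝟙 (bothᵇ hasFreeMate e)
      ≡⟨ cong (_+ ∑[ e ← M1 ] 𝟙 (bothᵇ hasFreeMate e)) (trans (sumOver-const M1 1) (*-identityʳ (length M1))) ⟩
    length M1 + ∑[ e ← M1 ] 𝟙 (bothᵇ hasFreeMate e) ∎
    where
    open ≤-Reasoning
    f : Fin n → ℕ
    f v = 𝟙 (hasFreeMate v)

  module _ (D : List (Fin n))
           (maximal : ∀ u v → T (adj G u v) → ¬ u ∈ D → ¬ v ∈ D → Covered M1 u ⊎ Covered M1 v) where

    charge : Fin n → ℕ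
    charge v = 𝟙 (coveredᵇ M1 v) + 𝟙 (coveredᵇ M1 v) * 𝟙 (hasFreeMate v) + 2 * 𝟙 (does (v ∈? D))

    covered-or-deleted : ∀ {x y} → T (adj G x y) → (Covered M1 x ⊎ Covered M1 y) ⊎ (T (does (x ∈? D)) ⊎ T (does (y ∈? D)))
    covered-or-deleted {x} {y} xy with x ∈? D | y ∈? D
    ... | yes _   | _       = inj₂ (inj₁ _)
    ... | no _    | yes _   = inj₂ (inj₂ _)
    ... | no x∉D  | no y∉D  = inj₁ (maximal x y xy x∉D y∉D)

    charge-edge : IsMatching G M* → ∀ {x y} → (x , y) ∈ M* → 2 ≤ charge x + charge y
    charge-edge M*-matching@(inG , _) {x} {y} xy∈M*
      rewrite partner-of (IsMatching⇒IsMatchingList G M*-matching) (inj₁ xy∈M*)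
            | partner-of (IsMatching⇒IsMatchingList G M*-matching) (inj₂ xy∈M*)
      = charge-bound (coveredᵇ M1 x) (coveredᵇ M1 y) (does (x ∈? D)) (does (y ∈? D)) (covered-or-deleted (inG xy∈M*))

    maximum-matching-bound : IsMatching G M* → IsMatching G M1 →
      2 * length M* ≤ 2 * length M1 + (length M1 + ∑[ e ← M1 ] 𝟙 (bothᵇ hasFreeMate e)) + 2 * length D
    maximum-matching-bound M*-matching M1-matching = begin
      2 * length M*                      ≡⟨ trans (*-comm 2 (length M*)) (sym (sumOver-const M* 2)) ⟩
      ∑[ e ← M* ] 2                      ≤⟨ sumOver-mono-≤ M* (λ {(x , y)} → charge-edge M*-matching) ⟩
      ∑[ e ← M* ] bothEnds charge e      ≡⟨ handshake M* charge (proj₁ M*-list) ⟨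
      ∑[ v < n ] (deg M* v * charge v)   ≤⟨ ∑-deg*≤∑ M* charge (proj₂ M*-list) ⟩
      ∑[ v < n ] charge v                ≡⟨ ∑-distrib-+ (λ v → cov v + cov v * fm v) (λ v → 2 * del v) ⟩
      ∑[ v < n ] (cov v + cov v * fm v) + ∑[ v < n ] (2 * del v)
                                         ≡⟨ cong₂ _+_ (∑-distrib-+ cov (λ v → cov v * fm v)) (sym (*-distribˡ-sum 2 del)) ⟩
      ∑[ v < n ] cov v + ∑[ v < n ] (cov v * fm v) + 2 * ∑[ v < n ] del v
                                         ≤⟨ +-mono-≤ (+-mono-≤ (∑-covered≤2*length M1 M1-loopless) (∑-covered*freeMate≤ M1-loopless))
                                                     (*-monoʳ-≤ 2 (∑-∈?≤length D)) ⟩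
      2 * length M1 + (length M1 + ∑[ e ← M1 ] 𝟙 (bothᵇ hasFreeMate e)) + 2 * length D ∎
      where
      open ≤-Reasoning
      M*-list : IsMatchingList M*
      M*-list = IsMatching⇒IsMatchingList G M*-matching
      M1-loopless : Loopless M1
      M1-loopless = proj₁ (IsMatching⇒IsMatchingList G M1-matching)
      cov fm del : Fin n → ℕ
      cov v = 𝟙 (coveredᵇ M1 v)
      fm v = 𝟙 (hasFreeMate v)
      del v = 𝟙 (does (v ∈? D))

  module _ (s0 : Fin n → Bool) where

    -- Meant for v ∈ V(M1), whose side is s0 v: its M*-partner is free and σ puts it on the other side.
    hasFreeMateAcross : Vec Bool n → Fin n → Bool
    hasFreeMateAcross σ v = maybe′ (λ w → not (coveredᵇ M1 w) ∧ (s0 v xor lookup σ w)) false (partner M* v)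

    module _ {v : Fin n} where

      side-covered : ∀ σ → Covered M1 v → side M1 s0 σ v ≡ s0 v
      side-covered σ c with coveredᵇ M1 v
      ... | true  = refl
      ... | false = ⊥-elim c

      side-uncovered : ∀ σ → ¬ Covered M1 v → side M1 s0 σ v ≡ lookup σ v
      side-uncovered σ u with coveredᵇ M1 v
      ... | true  = ⊥-elim (u _)
      ... | false = refl

      cap-covered : ∀ {b} → Covered M1 v → cap M1 b v ≡ 1
      cap-covered c with coveredᵇ M1 v
      ... | true  = refl
      ... | false = ⊥-elim c

      cap-uncovered : ∀ {b} → ¬ Covered M1 v → cap M1 b v ≡ b
      cap-uncovered u with coveredᵇ M1 v
      ... | true  = ⊥-elim (u _)
      ... | false = refl

    module _ (b : ℕ) (σ : Vec Bool n) (M2 : List (Edge n)) (M2-maximal : IsMaximalBMatching G M1 s0 b σ M2) where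

      stranded : Fin n → Bool
      stranded v = not (isMatched M2 v) ∧ hasFreeMateAcross σ v

      saturated : Fin n → Bool
      saturated w = not (coveredᵇ M1 w) ∧ (b ≤ᵇ deg M2 w)

      M2-loopless : Loopless M2
      M2-loopless xy∈M2 with proj₁ M2-maximal xy∈M2
      ... | inj₁ (xy , _) = adj⇒≢ G xy
      ... | inj₂ (yx , _) = adj⇒≢ G yx ∘ sym

      M2-partner-of-covered : ∀ {x a} → Covered M1 x → partner M2 x ≡ just a →
                              ¬ Covered M1 a × side M1 s0 σ x ≢ side M1 s0 σ a
      M2-partner-of-covered {x} x-cov xa with partner-InList M2 x xa
      ... | inj₁ xa∈M2 with proj₁ M2-maximal xa∈M2
      ...   | inj₁ (_ , _ , a-free , opposite) = a-free , opposite
      ...   | inj₂ (_ , _ , x-free , _)        = ⊥-elim (x-free x-cov)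
      M2-partner-of-covered x-cov xa | inj₂ ax∈M2 with proj₁ M2-maximal ax∈M2
      ...   | inj₁ (_ , _ , x-free , _)        = ⊥-elim (x-free x-cov)
      ...   | inj₂ (_ , _ , a-free , opposite) = a-free , opposite

      unmatched⇒neighbour-saturated : ∀ {v w} → T (adj G v w) → Covered M1 v → ¬ Covered M1 w →
                                      s0 v ≢ lookup σ w → partner M2 v ≡ nothing → b ≤ deg M2 w
      unmatched⇒neighbour-saturated {v} {w} vw v-cov w-free opposite v-unmatched
        with proj₂ (proj₂ M2-maximal) v w (vw , v-cov , w-free , opposite-sides)
        where
        opposite-sides : side M1 s0 σ v ≢ side M1 s0 σ w
        opposite-sides eq = opposite (trans (sym (side-covered σ v-cov)) (trans eq (side-uncovered σ w-free)))
      ... | inj₁ cap≤deg = ⊥-elim (1+n≰n (subst₂ _≤_ (cap-covered v-cov) (partner≡nothing⇒deg≡0 M2 v v-unmatched) cap≤deg))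
      ... | inj₂ cap≤deg = subst (_≤ deg M2 w) (cap-uncovered w-free) cap≤deg

      stranded⇒mate-saturated : (∀ {e} → e ∈ M* → InG G e) → IsMatching G M1 →
                                ∀ v → deg M1 v * 𝟙 (stranded v) ≤ maybe′ (𝟙 ∘ saturated) 0 (partner M* v)
      stranded⇒mate-saturated M*⊆G (_ , M1-deg≤1) v with partner M2 v in v-unmatched | partner M* v in mate
      ... | just _  | _       = *0≤ (deg M1 v)
      ... | nothing | nothing = *0≤ (deg M1 v)
      ... | nothing | just w  with coveredᵇ M1 w in w-cov | s0 v xor lookup σ w in opposite
      ...   | true  | _     = *0≤ (deg M1 v)
      ...   | false | false = *0≤ (deg M1 v)
      ...   | false | true  with coveredᵇ M1 v in v-cov
      ...     | false = ≤-trans (≤-reflexive (cong (_* 1) (uncovered⇒deg≡0 M1 v (subst T v-cov)))) z≤n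
      ...     | true  = subst (λ t → deg M1 v * 1 ≤ 𝟙 t) (sym (T-≡ .Equivalence.to (≤⇒≤ᵇ w-saturated)))
                          (≤-trans (≤-reflexive (*-identityʳ _)) (M1-deg≤1 v))
        where
        vw : T (adj G v w)
        vw with partner-InList M* v mate
        ... | inj₁ vw∈M* = M*⊆G vw∈M*
        ... | inj₂ wv∈M* = subst T (Graph.sym G w v) (M*⊆G wv∈M*)
        w-saturated : b ≤ deg M2 w
        w-saturated = unmatched⇒neighbour-saturated vw (subst T (sym v-cov) _) (subst T w-cov)
                        (xor≡true⇒≢ _ _ opposite) v-unmatched

      ∑-stranded≤∑-saturated : IsMatching G M* → IsMatching G M1 →
                               ∑[ v < n ] (deg M1 v * 𝟙 (stranded v)) ≤ ∑[ v < n ] 𝟙 (saturated v)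
      ∑-stranded≤∑-saturated M*-matching@(M*⊆G , M*-deg≤1) M1-matching = begin
        ∑[ v < n ] (deg M1 v * 𝟙 (stranded v))            ≤⟨ ∑-mono-≤ (stranded⇒mate-saturated M*⊆G M1-matching) ⟩
        ∑[ v < n ] maybe′ (𝟙 ∘ saturated) 0 (partner M* v) ≡⟨ ∑-partner (IsMatching⇒IsMatchingList G M*-matching) (𝟙 ∘ saturated) ⟩
        ∑[ v < n ] (deg M* v * 𝟙 (saturated v))           ≤⟨ ∑-deg*≤∑ M* (𝟙 ∘ saturated) M*-deg≤1 ⟩
        ∑[ v < n ] 𝟙 (saturated v)                        ∎
        where open ≤-Reasoning

      b*∑saturated≤2*|M1| : IsMatching G M1 → b * ∑[ v < n ] 𝟙 (saturated v) ≤ 2 * length M1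
      b*∑saturated≤2*|M1| M1-matching = begin
        b * ∑[ v < n ] 𝟙 (saturated v)          ≡⟨ *-distribˡ-sum b (𝟙 ∘ saturated) ⟩
        ∑[ v < n ] (b * 𝟙 (saturated v))        ≤⟨ ∑-mono-≤ b*saturated≤ ⟩
        ∑[ v < n ] (deg M2 v * free v)          ≡⟨ handshake M2 free M2-loopless ⟩
        ∑[ e ← M2 ] bothEnds free e             ≡⟨ sumOver-cong M2 one-end-covered ⟩
        ∑[ e ← M2 ] bothEnds cov e              ≡⟨ handshake M2 cov M2-loopless ⟨
        ∑[ v < n ] (deg M2 v * cov v)           ≤⟨ ∑-mono-≤ covered-capacity ⟩
        ∑[ v < n ] cov v                        ≤⟨ ∑-covered≤2*length M1 (proj₁ (IsMatching⇒IsMatchingList G M1-matching)) ⟩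
        2 * length M1                           ∎
        where
        open ≤-Reasoning
        cov free : Fin n → ℕ
        cov v  = 𝟙 (coveredᵇ M1 v)
        free v = 𝟙 (not (coveredᵇ M1 v))
        b*saturated≤ : ∀ w → b * 𝟙 (saturated w) ≤ deg M2 w * free w
        b*saturated≤ w with coveredᵇ M1 w | b ≤ᵇ deg M2 w in b≤d
        ... | true  | _     = *0≤ b
        ... | false | false = *0≤ b
        ... | false | true  = subst₂ _≤_ (sym (*-identityʳ b)) (sym (*-identityʳ _)) (≤ᵇ⇒≤ b (deg M2 w) (subst T (sym b≤d) _))
        one-end-covered : ∀ {e} → e ∈ M2 → bothEnds free e ≡ bothEnds cov e
        one-end-covered {x , y} xy∈M2 with proj₁ M2-maximal xy∈M2
        ... | inj₁ (_ , x-cov , y-free , _) = 𝟙-not-+-swap (coveredᵇ M1 x) (coveredᵇ M1 y) (inj₁ (x-cov , y-free))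
        ... | inj₂ (_ , y-cov , x-free , _) = 𝟙-not-+-swap (coveredᵇ M1 x) (coveredᵇ M1 y) (inj₂ (y-cov , x-free))
        covered-capacity : ∀ v → deg M2 v * cov v ≤ cov v
        covered-capacity v with coveredᵇ M1 v in v-cov
        ... | false = *0≤ (deg M2 v)
        ... | true  = ≤-trans (≤-reflexive (*-identityʳ (deg M2 v)))
                              (≤-trans (proj₁ (proj₂ M2-maximal) v) (≤-reflexive (cap-covered (subst T (sym v-cov) _))))

      per-outcome-bound : IsMatching G M* → IsMatching G M1 →
        b * ∑[ e ← M1 ] 𝟙 (bothᵇ (hasFreeMateAcross σ) e) ≤ b * length (pathsAlong M2 M1) + 2 * length M1
      per-outcome-bound M*-matching M1-matching = begin
        b * ∑[ e ← M1 ] 𝟙 (bothᵇ good e)              ≤⟨ *-monoʳ-≤ b paths+saturated ⟩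
        b * (length (pathsAlong M2 M1) + ∑[ v < n ] 𝟙 (saturated v))
                                                      ≡⟨ *-distribˡ-+ b (length (pathsAlong M2 M1)) _ ⟩
        b * length (pathsAlong M2 M1) + b * ∑[ v < n ] 𝟙 (saturated v)
                                                      ≤⟨ +-monoʳ-≤ (b * length (pathsAlong M2 M1)) (b*∑saturated≤2*|M1| M1-matching) ⟩
        b * length (pathsAlong M2 M1) + 2 * length M1 ∎
        where
        open ≤-Reasoning
        good : Fin n → Bool
        good = hasFreeMateAcross σ
        paths+saturated : ∑[ e ← M1 ] 𝟙 (bothᵇ good e) ≤ length (pathsAlong M2 M1) + ∑[ v < n ] 𝟙 (saturated v)
        paths+saturated = begin
          ∑[ e ← M1 ] 𝟙 (bothᵇ good e)
            ≤⟨ sumOver-mono-≤ M1 (λ {(x , y)} _ → 𝟙∧≤matched+stranded (good x) (good y) (isMatched M2 x) (isMatched M2 y)) ⟩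
          ∑[ e ← M1 ] (𝟙 (bothᵇ (isMatched M2) e) + bothEnds (𝟙 ∘ stranded) e)
            ≡⟨ sumOver-distrib-+ M1 (𝟙 ∘ bothᵇ (isMatched M2)) (bothEnds (𝟙 ∘ stranded)) ⟩
          ∑[ e ← M1 ] 𝟙 (bothᵇ (isMatched M2) e) + ∑[ e ← M1 ] bothEnds (𝟙 ∘ stranded) e
            ≡⟨ cong₂ _+_ (length-pathsAlong M2 M1)
                         (handshake M1 (𝟙 ∘ stranded) (proj₁ (IsMatching⇒IsMatchingList G M1-matching))) ⟨
          length (pathsAlong M2 M1) + ∑[ v < n ] (deg M1 v * 𝟙 (stranded v))
            ≤⟨ +-monoʳ-≤ (length (pathsAlong M2 M1)) (∑-stranded≤∑-saturated M*-matching M1-matching) ⟩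
          length (pathsAlong M2 M1) + ∑[ v < n ] 𝟙 (saturated v) ∎

      pathsAlong-augmenting : (∀ {x y} → (x , y) ∈ M1 → s0 x ≢ s0 y) →
                              ∀ {p} → p ∈ pathsAlong M2 M1 → Is3AugIn M1 M2 p
      pathsAlong-augmenting s0-splits {path a x y a′} p∈ with ∈-pathsAlong M2 p∈
      ... | xy∈M1 , xa , ya′ =
        inj₁ xy∈M1 , a-free , a′-free , a≢a′ ,
        inj₂ (InList-swap (partner-InList M2 x xa)) , inj₂ (partner-InList M2 y ya′)
        where
        x-cov : Covered M1 x
        x-cov = ∈⇒Covered x xy∈M1 (isEnd-fst x y)
        y-cov : Covered M1 y
        y-cov = ∈⇒Covered y xy∈M1 (isEnd-snd x y)
        a-free : ¬ Covered M1 a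
        a-free = proj₁ (M2-partner-of-covered x-cov xa)
        a′-free : ¬ Covered M1 a′
        a′-free = proj₁ (M2-partner-of-covered y-cov ya′)
        a≢a′ : a ≢ a′
        a≢a′ refl = s0-splits xy∈M1 (begin
          s0 x                ≡⟨ side-covered σ x-cov ⟨
          side M1 s0 σ x      ≡⟨ not-injective (trans (sym (¬-not (proj₂ (M2-partner-of-covered x-cov xa) ∘ sym)))
                                                      (¬-not (proj₂ (M2-partner-of-covered y-cov ya′) ∘ sym))) ⟩
          side M1 s0 σ y      ≡⟨ side-covered σ y-cov ⟩
          s0 y                ∎)
          where open ≡-Reasoning

    -- The M*-partners of x and y are distinct free vertices, so their sides are independent fair coins.
    ∑-bothAcross : IsMatching G M* → IsMatching G M1 → ∀ {x y} → (x , y) ∈ M1 →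
      4 * ∑[ σ ← allVecs n ] 𝟙 (bothᵇ (hasFreeMateAcross σ) (x , y)) ≡ 2 ^ n * 𝟙 (bothᵇ hasFreeMate (x , y))
    ∑-bothAcross M*-matching (M1⊆G , _) {x} {y} xy∈M1 with partner M* x in px | partner M* y in py
    ... | nothing | _       = ∑-allVecs-vanish n (λ _ → refl) refl
    ... | just w  | nothing = ∑-allVecs-vanish n (λ _ → cong 𝟙 (∧-zeroʳ _)) (cong 𝟙 (∧-zeroʳ _))
    ... | just w  | just w′ with coveredᵇ M1 w | coveredᵇ M1 w′
    ...   | true  | _     = ∑-allVecs-vanish n (λ _ → refl) refl
    ...   | false | true  = ∑-allVecs-vanish n (λ _ → cong 𝟙 (∧-zeroʳ _)) refl
    ...   | false | false = begin
      4 * ∑[ σ ← allVecs n ] 𝟙 ((s0 x xor lookup σ w) ∧ (s0 y xor lookup σ w′))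
        ≡⟨ ∑-allVecs-lookup₂ n w≢w′ (λ a c → 𝟙 ((s0 x xor a) ∧ (s0 y xor c))) ⟩
      2 ^ n * _
        ≡⟨ cong (2 ^ n *_) (𝟙-xor-∧-total (s0 x) (s0 y)) ⟩
      2 ^ n * 1 ∎
      where
      open ≡-Reasoning
      w≢w′ : w ≢ w′
      w≢w′ refl = adj⇒≢ G (M1⊆G xy∈M1) (partner-injective (IsMatching⇒IsMatchingList G M*-matching) px py)

    2^n*freeMates≡4*∑across : IsMatching G M* → IsMatching G M1 →
      2 ^ n * ∑[ e ← M1 ] 𝟙 (bothᵇ hasFreeMate e)
        ≡ 4 * ∑[ σ ← allVecs n ] (∑[ e ← M1 ] 𝟙 (bothᵇ (hasFreeMateAcross σ) e))
    2^n*freeMates≡4*∑across M*-matching M1-matching = begin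
      2 ^ n * ∑[ e ← M1 ] 𝟙 (bothᵇ hasFreeMate e)
        ≡⟨ sumOver-distribˡ-* M1 (2 ^ n) _ ⟨
      ∑[ e ← M1 ] (2 ^ n * 𝟙 (bothᵇ hasFreeMate e))
        ≡⟨ sumOver-cong M1 (λ {(x , y)} xy∈M1 → sym (∑-bothAcross M*-matching M1-matching xy∈M1)) ⟩
      ∑[ e ← M1 ] (4 * ∑[ σ ← allVecs n ] 𝟙 (bothᵇ (hasFreeMateAcross σ) e))
        ≡⟨ sumOver-distribˡ-* M1 4 _ ⟩
      4 * ∑[ e ← M1 ] (∑[ σ ← allVecs n ] 𝟙 (bothᵇ (hasFreeMateAcross σ) e))
        ≡⟨ cong (4 *_) (sumOver-comm M1 (allVecs n) _) ⟩
      4 * ∑[ σ ← allVecs n ] (∑[ e ← M1 ] 𝟙 (bothᵇ (hasFreeMateAcross σ) e)) ∎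
      where open ≡-Reasoning

    ∑-per-outcome-bound : IsMatching G M* → IsMatching G M1 → ∀ b (M2 : Vec Bool n → List (Edge n)) →
      (∀ σ → IsMaximalBMatching G M1 s0 b σ (M2 σ)) →
      b * ∑[ σ ← allVecs n ] (∑[ e ← M1 ] 𝟙 (bothᵇ (hasFreeMateAcross σ) e))
        ≤ b * ∑[ σ ← allVecs n ] length (pathsAlong (M2 σ) M1) + 2 ^ n * (2 * length M1)
    ∑-per-outcome-bound M*-matching M1-matching b M2 M2-maximal = begin
      b * ∑[ σ ← allVecs n ] (∑[ e ← M1 ] 𝟙 (bothᵇ (hasFreeMateAcross σ) e))
        ≡⟨ sumOver-distribˡ-* (allVecs n) b _ ⟨
      ∑[ σ ← allVecs n ] (b * ∑[ e ← M1 ] 𝟙 (bothᵇ (hasFreeMateAcross σ) e))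
        ≤⟨ sumOver-mono-≤ (allVecs n) (λ {σ} _ → per-outcome-bound b σ (M2 σ) (M2-maximal σ) M*-matching M1-matching) ⟩
      ∑[ σ ← allVecs n ] (b * length (pathsAlong (M2 σ) M1) + 2 * length M1)
        ≡⟨ sumOver-distrib-+ (allVecs n) (λ σ → b * length (pathsAlong (M2 σ) M1)) (λ _ → 2 * length M1) ⟩
      ∑[ σ ← allVecs n ] (b * length (pathsAlong (M2 σ) M1)) + ∑[ σ ← allVecs n ] (2 * length M1)
        ≡⟨ cong₂ _+_ (sumOver-distribˡ-* (allVecs n) b _) (∑-allVecs-const n (2 * length M1)) ⟩
      b * ∑[ σ ← allVecs n ] length (pathsAlong (M2 σ) M1) + 2 ^ n * (2 * length M1) ∎
      where open ≤-Reasoning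

-- From ℕ to ℚ

-- Imported only here: ℤ's prefix +_ would make ℕ sections such as (k +_) above ambiguous.
open import Data.Integer using (+_)

toℚᵘ-ℕtoℚ : ∀ k → ℚ.toℚᵘ (ℕtoℚ k) ℚᵘ.≃ ℚᵘ.mkℚᵘ (+ k) 0
toℚᵘ-ℕtoℚ k = ℚₚ.toℚᵘ-fromℚᵘ (ℚᵘ.mkℚᵘ (+ k) 0)

ℕtoℚ-+ : ∀ a b → ℕtoℚ (a + b) ≡ ℕtoℚ a ℚ.+ ℕtoℚ b
ℕtoℚ-+ a b = ℚₚ.toℚᵘ-injective (begin
  ℚ.toℚᵘ (ℕtoℚ (a + b))                                ≈⟨ toℚᵘ-ℕtoℚ (a + b) ⟩
  ℚᵘ.mkℚᵘ (+ (a + b)) 0                                ≈⟨ ℚᵘ.*≡* integers ⟩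
  ℚᵘ.mkℚᵘ (+ a) 0 ℚᵘ.+ ℚᵘ.mkℚᵘ (+ b) 0                 ≈⟨ ℚᵘₚ.+-cong (toℚᵘ-ℕtoℚ a) (toℚᵘ-ℕtoℚ b) ⟨
  ℚ.toℚᵘ (ℕtoℚ a) ℚᵘ.+ ℚ.toℚᵘ (ℕtoℚ b)                 ≈⟨ ℚₚ.toℚᵘ-homo-+ (ℕtoℚ a) (ℕtoℚ b) ⟨
  ℚ.toℚᵘ (ℕtoℚ a ℚ.+ ℕtoℚ b)                           ∎)
  where
  open ℚᵘₚ.≃-Reasoning
  open ℤ-Solver.+-*-Solver
  integers : + (a + b) ℤ.* + 1 ≡ (+ a ℤ.* + 1 ℤ.+ + b ℤ.* + 1) ℤ.* + 1
  integers = trans (cong (ℤ._* + 1) (ℤₚ.pos-+ a b))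
                   (solve 2 (λ A B → (A :+ B) :* con (+ 1) := (A :* con (+ 1) :+ B :* con (+ 1)) :* con (+ 1)) refl (+ a) (+ b))

ℕtoℚ-* : ∀ a b → ℕtoℚ (a * b) ≡ ℕtoℚ a ℚ.* ℕtoℚ b
ℕtoℚ-* a b = ℚₚ.toℚᵘ-injective (begin
  ℚ.toℚᵘ (ℕtoℚ (a * b))                                ≈⟨ toℚᵘ-ℕtoℚ (a * b) ⟩
  ℚᵘ.mkℚᵘ (+ (a * b)) 0                                ≈⟨ ℚᵘ.*≡* integers ⟩
  ℚᵘ.mkℚᵘ (+ a) 0 ℚᵘ.* ℚᵘ.mkℚᵘ (+ b) 0                 ≈⟨ ℚᵘₚ.*-cong (toℚᵘ-ℕtoℚ a) (toℚᵘ-ℕtoℚ b) ⟨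
  ℚ.toℚᵘ (ℕtoℚ a) ℚᵘ.* ℚ.toℚᵘ (ℕtoℚ b)                 ≈⟨ ℚₚ.toℚᵘ-homo-* (ℕtoℚ a) (ℕtoℚ b) ⟨
  ℚ.toℚᵘ (ℕtoℚ a ℚ.* ℕtoℚ b)                           ∎)
  where
  open ℚᵘₚ.≃-Reasoning
  open ℤ-Solver.+-*-Solver
  integers : + (a * b) ℤ.* + 1 ≡ (+ a ℤ.* + b) ℤ.* (+ 1 ℤ.* + 1)
  integers = trans (cong (ℤ._* + 1) (ℤₚ.pos-* a b))
                   (solve 2 (λ A B → (A :* B) :* con (+ 1) := (A :* B) :* (con (+ 1) :* con (+ 1))) refl (+ a) (+ b))

ℕtoℚ-*-/ : ∀ k d .{{_ : NonZero d}} → ℕtoℚ d ℚ.* (+ k / d) ≡ ℕtoℚ k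
ℕtoℚ-*-/ k (suc d) = ℚₚ.toℚᵘ-injective (begin
  ℚ.toℚᵘ (ℕtoℚ (suc d) ℚ.* (+ k / suc d))                       ≈⟨ ℚₚ.toℚᵘ-homo-* (ℕtoℚ (suc d)) (+ k / suc d) ⟩
  ℚ.toℚᵘ (ℕtoℚ (suc d)) ℚᵘ.* ℚ.toℚᵘ (+ k / suc d)              ≈⟨ ℚᵘₚ.*-cong (toℚᵘ-ℕtoℚ (suc d)) (ℚₚ.toℚᵘ-fromℚᵘ (ℚᵘ.mkℚᵘ (+ k) d)) ⟩
  ℚᵘ.mkℚᵘ (+ suc d) 0 ℚᵘ.* ℚᵘ.mkℚᵘ (+ k) d                      ≈⟨ ℚᵘ.*≡* integers ⟩
  ℚᵘ.mkℚᵘ (+ k) 0                                               ≈⟨ toℚᵘ-ℕtoℚ k ⟨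
  ℚ.toℚᵘ (ℕtoℚ k)                                               ∎)
  where
  open ℚᵘₚ.≃-Reasoning
  open ℤ-Solver.+-*-Solver
  integers : (+ suc d ℤ.* + k) ℤ.* + 1 ≡ + k ℤ.* (+ 1 ℤ.* + suc d)
  integers = solve 2 (λ D K → (D :* K) :* con (+ 1) := K :* (con (+ 1) :* D)) refl (+ suc d) (+ k)

ℕtoℚ-nonNeg : ∀ k → 0ℚ ℚ.≤ ℕtoℚ k
ℕtoℚ-nonNeg k = ℚₚ.nonNegative⁻¹ (ℕtoℚ k) {{ℚₚ.normalize-nonNeg k 1}}

ℕtoℚ-pos : ∀ k .{{_ : NonZero k}} → 0ℚ ℚ.< ℕtoℚ k
ℕtoℚ-pos k = ℚₚ.positive⁻¹ (ℕtoℚ k) {{ℚₚ.normalize-pos k 1}}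

ℕtoℚ-mono-≤ : ∀ {a b} → a ≤ b → ℕtoℚ a ℚ.≤ ℕtoℚ b
ℕtoℚ-mono-≤ {a} {b} a≤b = begin
  ℕtoℚ a                  ≡⟨ ℚₚ.+-identityʳ (ℕtoℚ a) ⟨
  ℕtoℚ a ℚ.+ 0ℚ           ≤⟨ ℚₚ.+-monoʳ-≤ (ℕtoℚ a) (ℕtoℚ-nonNeg (b ∸ a)) ⟩
  ℕtoℚ a ℚ.+ ℕtoℚ (b ∸ a) ≡⟨ ℕtoℚ-+ a (b ∸ a) ⟨
  ℕtoℚ (a + (b ∸ a))      ≡⟨ cong ℕtoℚ (m+[n∸m]≡n a≤b) ⟩
  ℕtoℚ b                  ∎
  where open ℚₚ.≤-Reasoning

sumℚ-ℕtoℚ : ∀ (xs : List A) (f : A → ℕ) → sumℚ (map (λ x → ℕtoℚ (f x)) xs) ≡ ℕtoℚ (∑[ x ← xs ] f x)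
sumℚ-ℕtoℚ []       f = refl
sumℚ-ℕtoℚ (x ∷ xs) f = trans (cong (ℕtoℚ (f x) ℚ.+_) (sumℚ-ℕtoℚ xs f)) (sym (ℕtoℚ-+ (f x) _))

p≤q⇒0≤q-p : ∀ {p q} → p ℚ.≤ q → 0ℚ ℚ.≤ q ℚ.- p
p≤q⇒0≤q-p {p} {q} p≤q = ℚₚ.≤-trans (ℚₚ.≤-reflexive (sym (ℚₚ.+-inverseʳ p))) (ℚₚ.+-monoˡ-≤ (ℚ.- p) p≤q)

0≤+ : ∀ {p q} → 0ℚ ℚ.≤ p → 0ℚ ℚ.≤ q → 0ℚ ℚ.≤ p ℚ.+ q
0≤+ 0≤p 0≤q = ℚₚ.+-mono-≤ 0≤p 0≤q

0≤* : ∀ {p q} → 0ℚ ℚ.≤ p → 0ℚ ℚ.≤ q → 0ℚ ℚ.≤ p ℚ.* q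
0≤* {p} {q} 0≤p 0≤q = ℚₚ.≤-trans (ℚₚ.≤-reflexive (sym (ℚₚ.*-zeroʳ p))) (ℚₚ.*-monoˡ-≤-nonNeg p {{ℚ.nonNegative 0≤p}} 0≤q)

certificate : ∀ (β N X TT k d μ c ε τ ι m : ℚ) → 0ℚ ℚ.< β → 0ℚ ℚ.< N →
  0ℚ ℚ.≤ d → d ℚ.≤ ε ℚ.* (+ 1 / 4) ℚ.* μ → β ℚ.* τ ≡ ℕtoℚ 2 → N ℚ.* ι ≡ 1ℚ → m ≡ (½ ℚ.+ c) ℚ.* μ →
  ℕtoℚ 2 ℚ.* μ ℚ.≤ ℕtoℚ 2 ℚ.* m ℚ.+ (m ℚ.+ k) ℚ.+ ℕtoℚ 2 ℚ.* d →
  N ℚ.* k ℚ.≤ ℕtoℚ 4 ℚ.* TT →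
  β ℚ.* TT ℚ.≤ β ℚ.* X ℚ.+ N ℚ.* (ℕtoℚ 2 ℚ.* m) →
  ((+ 1 / 4) ℚ.* (½ ℚ.- (+ 3 / 1) ℚ.* c ℚ.- (+ 7 / 2) ℚ.* ε) ℚ.- τ ℚ.* (½ ℚ.+ c)) ℚ.* μ ℚ.≤ X ℚ.* ι
certificate β N X TT k d μ c ε τ ι _ 0<β 0<N 0≤d d≤εμ/4 βτ≡2 Nι≡1 refl H₁ H₂ H₃ =
  ℚₚ.*-cancelˡ-≤-pos (β ℚ.* N) {{ℚₚ.pos*pos⇒pos β {{ℚ.positive 0<β}} N {{ℚ.positive 0<N}}}} (begin
    β ℚ.* N ℚ.* ((α ℚ.- τ ℚ.* (½ ℚ.+ c)) ℚ.* μ)        ≡⟨ solve 6 (λ β N α τ c μ → β :* N :* ((α :- τ :* (con ½ :+ c)) :* μ)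
                                                             := β :* N :* α :* μ :- N :* (β :* τ) :* ((con ½ :+ c) :* μ))
                                                             refl β N α τ c μ ⟩
    β ℚ.* N ℚ.* α ℚ.* μ ℚ.- N ℚ.* (β ℚ.* τ) ℚ.* m      ≡⟨ cong (λ t → β ℚ.* N ℚ.* α ℚ.* μ ℚ.- N ℚ.* t ℚ.* m) βτ≡2 ⟩
    L                                                  ≤⟨ ℚₚ.*-cancelˡ-≤-pos (ℕtoℚ 4) (begin
                                                            ℕtoℚ 4 ℚ.* L            ≡⟨ ℚₚ.+-identityʳ _ ⟨
                                                            ℕtoℚ 4 ℚ.* L ℚ.+ 0ℚ     ≤⟨ ℚₚ.+-monoʳ-≤ (ℕtoℚ 4 ℚ.* L) 0≤S ⟩
                                                            ℕtoℚ 4 ℚ.* L ℚ.+ S      ≡⟨ slack-identity ⟨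
                                                            ℕtoℚ 4 ℚ.* (β ℚ.* X)    ∎) ⟩
    β ℚ.* X                                            ≡⟨ ℚₚ.*-identityʳ (β ℚ.* X) ⟨
    β ℚ.* X ℚ.* 1ℚ                                     ≡⟨ cong (β ℚ.* X ℚ.*_) Nι≡1 ⟨
    β ℚ.* X ℚ.* (N ℚ.* ι)                              ≡⟨ solve 4 (λ β X N ι → β :* X :* (N :* ι) := β :* N :* (X :* ι)) refl β X N ι ⟩
    β ℚ.* N ℚ.* (X ℚ.* ι)                              ∎)
  where
  open ℚₚ.≤-Reasoning
  open ℚ-Solver.+-*-Solver
  m α L S : ℚ
  m = (½ ℚ.+ c) ℚ.* μ
  α = (+ 1 / 4) ℚ.* (½ ℚ.- (+ 3 / 1) ℚ.* c ℚ.- (+ 7 / 2) ℚ.* ε)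
  L = β ℚ.* N ℚ.* α ℚ.* μ ℚ.- N ℚ.* ℕtoℚ 2 ℚ.* m
  S = ℕtoℚ 4 ℚ.* (β ℚ.* X ℚ.+ N ℚ.* (ℕtoℚ 2 ℚ.* m) ℚ.- β ℚ.* TT)
      ℚ.+ β ℚ.* (ℕtoℚ 4 ℚ.* TT ℚ.- N ℚ.* k)
      ℚ.+ β ℚ.* N ℚ.* (ℕtoℚ 2 ℚ.* m ℚ.+ (m ℚ.+ k) ℚ.+ ℕtoℚ 2 ℚ.* d ℚ.- ℕtoℚ 2 ℚ.* μ)
      ℚ.+ β ℚ.* N ℚ.* ((+ 14 / 1) ℚ.* (ε ℚ.* (+ 1 / 4) ℚ.* μ ℚ.- d) ℚ.+ (+ 12 / 1) ℚ.* d)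
  0≤βN : 0ℚ ℚ.≤ β ℚ.* N
  0≤βN = ℚₚ.<⇒≤ (ℚₚ.positive⁻¹ (β ℚ.* N) {{ℚₚ.pos*pos⇒pos β {{ℚ.positive 0<β}} N {{ℚ.positive 0<N}}}})
  0≤S : 0ℚ ℚ.≤ S
  0≤S = 0≤+ (0≤+ (0≤+ (0≤* (ℕtoℚ-nonNeg 4) (p≤q⇒0≤q-p H₃)) (0≤* (ℚₚ.<⇒≤ 0<β) (p≤q⇒0≤q-p H₂)))
                 (0≤* 0≤βN (p≤q⇒0≤q-p H₁)))
            (0≤* 0≤βN (0≤+ (0≤* (ℕtoℚ-nonNeg 14) (p≤q⇒0≤q-p d≤εμ/4)) (0≤* (ℕtoℚ-nonNeg 12) 0≤d)))
  slack-identity : ℕtoℚ 4 ℚ.* (β ℚ.* X) ≡ ℕtoℚ 4 ℚ.* L ℚ.+ S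
  slack-identity = solve 9 (λ β N X TT k d μ c ε →
    let m = (con ½ :+ c) :* μ in
    con (ℕtoℚ 4) :* (β :* X)
      := con (ℕtoℚ 4) :* (β :* N :* (con (+ 1 / 4) :* (con ½ :- con (+ 3 / 1) :* c :- con (+ 7 / 2) :* ε)) :* μ
                           :- N :* con (ℕtoℚ 2) :* m)
         :+ (con (ℕtoℚ 4) :* (β :* X :+ N :* (con (ℕtoℚ 2) :* m) :- β :* TT)
             :+ β :* (con (ℕtoℚ 4) :* TT :- N :* k)
             :+ β :* N :* (con (ℕtoℚ 2) :* m :+ (m :+ k) :+ con (ℕtoℚ 2) :* d :- con (ℕtoℚ 2) :* μ)
             :+ β :* N :* (con (+ 14 / 1) :* (ε :* con (+ 1 / 4) :* μ :- d) :+ con (+ 12 / 1) :* d)))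
    refl β N X TT k d μ c ε

expectation-bound : ∀ (b N μ m1 d k TT X : ℕ) .{{_ : NonZero b}} .{{_ : NonZero N}} (c ε : ℚ) →
  ℕtoℚ m1 ≡ (½ ℚ.+ c) ℚ.* ℕtoℚ μ → ℕtoℚ d ℚ.≤ ε ℚ.* (+ 1 / 4) ℚ.* ℕtoℚ μ →
  2 * μ ≤ 2 * m1 + (m1 + k) + 2 * d → N * k ≡ 4 * TT → b * TT ≤ b * X + N * (2 * m1) →
  ((+ 1 / 4) ℚ.* (½ ℚ.- (+ 3 / 1) ℚ.* c ℚ.- (+ 7 / 2) ℚ.* ε) ℚ.- (+ 2 / b) ℚ.* (½ ℚ.+ c)) ℚ.* ℕtoℚ μ
    ℚ.≤ ℕtoℚ X ℚ.* (+ 1 / N)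
expectation-bound b N μ m1 d k TT X c ε m1≡ d≤ H₁ H₂ H₃ =
  certificate (ℕtoℚ b) (ℕtoℚ N) (ℕtoℚ X) (ℕtoℚ TT) (ℕtoℚ k) (ℕtoℚ d) (ℕtoℚ μ) c ε (+ 2 / b) (+ 1 / N) (ℕtoℚ m1)
    (ℕtoℚ-pos b) (ℕtoℚ-pos N) (ℕtoℚ-nonNeg d) d≤ (ℕtoℚ-*-/ 2 b) (ℕtoℚ-*-/ 1 N) m1≡
    (subst₂ ℚ._≤_ (ℕtoℚ-* 2 μ)
       (trans (ℕtoℚ-+ (2 * m1 + (m1 + k)) (2 * d))
              (cong₂ ℚ._+_ (trans (ℕtoℚ-+ (2 * m1) (m1 + k)) (cong₂ ℚ._+_ (ℕtoℚ-* 2 m1) (ℕtoℚ-+ m1 k))) (ℕtoℚ-* 2 d)))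
       (ℕtoℚ-mono-≤ H₁))
    (ℚₚ.≤-reflexive (trans (sym (ℕtoℚ-* N k)) (trans (cong ℕtoℚ H₂) (ℕtoℚ-* 4 TT))))
    (subst₂ ℚ._≤_ (ℕtoℚ-* b TT)
       (trans (ℕtoℚ-+ (b * X) (N * (2 * m1)))
              (cong₂ ℚ._+_ (ℕtoℚ-* b X) (trans (ℕtoℚ-* N (2 * m1)) (cong (ℕtoℚ N ℚ.*_) (ℕtoℚ-* 2 m1)))))
       (ℕtoℚ-mono-≤ H₃))

lemma4p2 : {n : ℕ} (G : Graph n) (μ : ℕ) → IsMaxMatchingSize G μ →
  (ε : ℚ) → 0ℚ ℚ.< ε → (b : ℕ) → .{{_ : NonZero b}} →
  (M1 : List (Edge n)) → IsApproxMaximal G μ (ε ℚ.* (+ 1 / 4)) M1 →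
  (s0 : Fin n → Bool) → (∀ {x y} → (x , y) ∈ M1 → s0 x ≢ s0 y) →
  (M2 : Vec Bool n → List (Edge n)) →
  (∀ σ → IsMaximalBMatching G M1 s0 b σ (M2 σ)) →
  (c : ℚ) → ℕtoℚ (length M1) ≡ (½ ℚ.+ c) ℚ.* ℕtoℚ μ →
  Σ (Vec Bool n → List (Path4 n)) λ P →
    (∀ σ → ValidPathSet M1 (M2 σ) (P σ)) ×
    (((+ 1 / 4) ℚ.* (½ ℚ.- (+ 3 / 1) ℚ.* c ℚ.- (+ 7 / 2) ℚ.* ε)
       ℚ.- (+ 2 / b) ℚ.* (½ ℚ.+ c)) ℚ.* ℕtoℚ μ
      ℚ.≤ Expect n (λ σ → length (P σ)))
lemma4p2 {n} G μ ((M* , M*-matching , |M*|≡μ) , _) ε _ b M1 (D , _ , |D|≤εμ/4 , M1-matching , _ , M1-maximal)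
         s0 s0-splits M2 M2-maximal c |M1|≡ =
  P , valid ,
  subst (_ ℚ.≤_) (cong (ℚ._* (+ 1 / 2 ^ n)) (sym (sumℚ-ℕtoℚ (allVecs n) (length ∘ P))))
    (expectation-bound b (2 ^ n) μ (length M1) (length D) k TT X c ε |M1|≡ |D|≤εμ/4 charged sampled averaged)
  where
  instance
    2^n≢0 : NonZero (2 ^ n)
    2^n≢0 = m^n≢0 2 n
  P : Vec Bool n → List (Path4 n)
  P σ = pathsAlong (M2 σ) M1
  valid : ∀ σ → ValidPathSet M1 (M2 σ) (P σ)
  valid σ = pathsAlong-augmenting G M* M1 s0 b σ (M2 σ) (M2-maximal σ) s0-splits ,
            pathsAlong-disjoint (M2 σ) M1 (proj₂ M1-matching)
  k TT X : ℕ
  k = ∑[ e ← M1 ] 𝟙 (bothᵇ (hasFreeMate G M* M1) e)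
  TT = ∑[ σ ← allVecs n ] (∑[ e ← M1 ] 𝟙 (bothᵇ (hasFreeMateAcross G M* M1 s0 σ) e))
  X = ∑[ σ ← allVecs n ] length (P σ)
  charged : 2 * μ ≤ 2 * length M1 + (length M1 + k) + 2 * length D
  charged = subst (λ t → 2 * t ≤ _) |M*|≡μ (maximum-matching-bound G M* M1 D M1-maximal M*-matching M1-matching)
  sampled : 2 ^ n * k ≡ 4 * TT
  sampled = 2^n*freeMates≡4*∑across G M* M1 s0 M*-matching M1-matching
  averaged : b * TT ≤ b * X + 2 ^ n * (2 * length M1)
  averaged = ∑-per-outcome-bound G M* M1 s0 M*-matching M1-matching b M2 M2-maximal
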